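{- Let $k\ge1$ and let $S^{(k)}_n$ be the number of Schröder paths from $(0,0)$ to $(2n,0)$ (steps $(1,1)$, $(1,-1)$, $(2,0)$, unweighted) that stay in the strip $0\le y\le k-1$. Let $d_k(t)=\sum_{l=0}^{\lfloor k/2\rfloor}\binom{k-l}{l}t^l(1+t)^{k-2l}$ be the Delannoy polynomials. Then \[ \sum_{n\ge0}S^{(k)}_n t^n=\frac{d_{k-1}(-t)}{d_k(-t)} . \] -}

module Defs where

open import Data.Bool using (Bool; true; false; _∧_)
open import Data.Nat using (ℕ; zero; suc; _∸_; _/_; _<ᵇ_; _≡ᵇ_)
import Data.Nat as ℕ
open import Data.Nat.Combinatorics using (_C_)
open import Data.Integer using (ℤ; +_; -_; _+_; _*_; 0ℤ; 1ℤ)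
open import Data.List using (List; []; _∷_; map; _++_; length; filterᵇ; upTo; foldr)

-- Steps: U = (1,1), D = (1,-1), F = (2,0)
data Step : Set where
  U D F : Step

allWords : ℕ → List (List Step)
allWords zero = [] ∷ []
allWords (suc zero) = map (U ∷_) (allWords zero) ++ map (D ∷_) (allWords zero)
allWords (suc (suc m)) =
  map (U ∷_) (allWords (suc m)) ++ map (D ∷_) (allWords (suc m)) ++ map (F ∷_) (allWords m)

inStrip : ℕ → ℕ → List Step → Bool
inStrip k h [] = h ≡ᵇ 0
inStrip k h (U ∷ w) = (suc h <ᵇ k) ∧ inStrip k (suc h) w
inStrip k zero (D ∷ w) = false
inStrip k (suc h) (D ∷ w) = inStrip k h w
inStrip k h (F ∷ w) = inStrip k h w

S : ℕ → ℕ → ℕ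
S k n = length (filterᵇ (inStrip k 0) (allWords (2 ℕ.* n)))

-- Integer polynomials as coefficient lists (lowest degree first)

Poly : Set
Poly = List ℤ

_+P_ : Poly → Poly → Poly
[] +P q = q
(a ∷ p) +P [] = a ∷ p
(a ∷ p) +P (b ∷ q) = (a + b) ∷ (p +P q)

scaleP : ℤ → Poly → Poly
scaleP c = map (c *_)

_*P_ : Poly → Poly → Poly
[] *P q = []
(a ∷ p) *P q = scaleP a q +P (0ℤ ∷ (p *P q))

oneP : Poly
oneP = 1ℤ ∷ []

tP : Poly
tP = 0ℤ ∷ 1ℤ ∷ []

_^P_ : Poly → ℕ → Poly
p ^P zero = oneP
p ^P suc n = p *P (p ^P n)

sumP : List Poly → Poly
sumP = foldr _+P_ []

negArg : Poly → Poly
negArg [] = []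
negArg (a ∷ p) = a ∷ map -_ (negArg p)

coeff : Poly → ℕ → ℤ
coeff [] n = 0ℤ
coeff (a ∷ p) zero = a
coeff (a ∷ p) (suc n) = coeff p n

delannoy : ℕ → Poly
delannoy k = sumP (map (λ l → scaleP (+ ((k ∸ l) C l))
                                     ((tP ^P l) *P ((oneP +P tP) ^P (k ∸ 2 ℕ.* l))))
                       (upTo (suc (k / 2))))

sumℤ : List ℤ → ℤ
sumℤ = foldr _+_ 0ℤ

convCoeff : (ℕ → ℤ) → Poly → ℕ → ℤ
convCoeff a q n = sumℤ (map (λ i → a i * coeff q (n ∸ i)) (upTo (suc n)))

-- Fix k ≥ 1.  For 0 ≤ h < k let A_h(t) = Σₙ aₕ(n) tⁿ, where aₕ(n) counts the
-- U/D/F step sequences that start at height h, have horizontal length h + 2n,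
-- stay in the strip 0 ≤ y ≤ k-1 and end on the x-axis; A_0 is the series of
-- the theorem.  Splitting off the first step gives the linear system
--     A_0 = 1 + t A_1 + t A_0,      A_{h+1} = t A_{h+2} + A_h + t A_{h+1},
-- with A_k := 0.  The Delannoy polynomials satisfy d_{j+2} = (1+t) d_{j+1} + t d_j
-- (termwise Pascal's rule), so D_j := d_{j-1}(-t), D_0 := 0, satisfies
-- D_{j+1} = D_{j+2} + t D_{j+1} + t D_j; hence A_h · d_k(-t) = D_{k-h} is
-- consistent with the system, and a simultaneous induction on the coefficient
-- index n and on h proves it.
module Submission where

open import Defs
open import Data.Bool using (Bool; true; false; _∧_; if_then_else_)
open import Data.Nat using (ℕ; zero; suc; _∸_; _≥_; _≤_; _<_; _<ᵇ_; _/_; _%_; z≤n; s≤s)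
import Data.Nat as ℕ
import Data.Nat.Properties as ℕP
open import Data.Nat.DivMod using (m≡m%n+[m/n]*n; m%n<n; m/n≤m)
open import Data.Nat.Combinatorics using (_C_; nCk+nC[k+1]≡[n+1]C[k+1])
open import Data.Nat.Combinatorics.Specification using (k>n⇒nCk≡0)
open import Data.Integer using (ℤ; +_; -_; _+_; _*_; 0ℤ; 1ℤ)
import Data.Integer.Properties as ℤP
open import Data.Integer.Tactic.RingSolver using (solve-∀)
open import Data.List using (List; []; _∷_; map; _++_; length; filterᵇ; applyUpTo)
open import Data.List.Properties using (length-++; filter-++)
open import Relation.Nullary using (yes; no)
open import Relation.Nullary.Decidable using (T?)
open import Relation.Binary.PropositionalEquality
open ≡-Reasoning

Series : Set
Series = ℕ → ℤ

zeroS : Series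
zeroS _ = 0ℤ

δ₀ : Series
δ₀ zero = 1ℤ
δ₀ (suc n) = 0ℤ

infixl 6 _⊕_
_⊕_ : Series → Series → Series
(f ⊕ g) n = f n + g n

shift : Series → Series
shift f zero = 0ℤ
shift f (suc n) = f n

shiftBy : ℕ → Series → Series
shiftBy zero f = f
shiftBy (suc l) f = shift (shiftBy l f)

shift-cong : ∀ {f g} → f ≗ g → shift f ≗ shift g
shift-cong e zero = refl
shift-cong e (suc n) = e n

shift-zero : shift zeroS ≗ zeroS
shift-zero zero = refl
shift-zero (suc n) = refl

shiftBy-cong : ∀ l {f g} → f ≗ g → shiftBy l f ≗ shiftBy l g
shiftBy-cong zero e = e
shiftBy-cong (suc l) e = shift-cong (shiftBy-cong l e)

shiftBy-⊕ : ∀ l f g → shiftBy l (f ⊕ g) ≗ shiftBy l f ⊕ shiftBy l g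
shiftBy-⊕ zero f g n = refl
shiftBy-⊕ (suc l) f g zero = refl
shiftBy-⊕ (suc l) f g (suc n) = shiftBy-⊕ l f g n

shiftBy-shift : ∀ l f → shiftBy l (shift f) ≗ shift (shiftBy l f)
shiftBy-shift zero f n = refl
shiftBy-shift (suc l) f zero = refl
shiftBy-shift (suc l) f (suc n) = shiftBy-shift l f n

sumTo : Series → ℕ → ℤ
sumTo f zero = 0ℤ
sumTo f (suc n) = f 0 + sumTo (λ i → f (suc i)) n

sumℤ-applyUpTo : ∀ (g : ℕ → ℤ) (f : ℕ → ℕ) m →
  sumℤ (map g (applyUpTo f m)) ≡ sumTo (λ i → g (f i)) m
sumℤ-applyUpTo g f zero = refl
sumℤ-applyUpTo g f (suc m) = cong (_+_ (g (f 0))) (sumℤ-applyUpTo g (λ i → f (suc i)) m)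

sumTo-cong : ∀ {f g} n → f ≗ g → sumTo f n ≡ sumTo g n
sumTo-cong zero e = refl
sumTo-cong (suc n) e = cong₂ _+_ (e 0) (sumTo-cong n (λ i → e (suc i)))

sumTo-⊕ : ∀ f g n → sumTo (f ⊕ g) n ≡ sumTo f n + sumTo g n
sumTo-⊕ f g zero = refl
sumTo-⊕ f g (suc n) = begin
  (f 0 + g 0) + sumTo (λ i → f (suc i) + g (suc i)) n
    ≡⟨ cong (_+_ (f 0 + g 0)) (sumTo-⊕ (λ i → f (suc i)) (λ i → g (suc i)) n) ⟩
  (f 0 + g 0) + (sumTo (λ i → f (suc i)) n + sumTo (λ i → g (suc i)) n)
    ≡⟨ interchange (f 0) (g 0) _ _ ⟩
  (f 0 + sumTo (λ i → f (suc i)) n) + (g 0 + sumTo (λ i → g (suc i)) n) ∎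
  where
  interchange : ∀ a b c d → (a + b) + (c + d) ≡ (a + c) + (b + d)
  interchange = solve-∀

sumTo-scale : ∀ c f n → sumTo (λ i → c * f i) n ≡ c * sumTo f n
sumTo-scale c f zero = sym (ℤP.*-zeroʳ c)
sumTo-scale c f (suc n) =
  trans (cong (_+_ (c * f 0)) (sumTo-scale c (λ i → f (suc i)) n))
        (sym (ℤP.*-distribˡ-+ c (f 0) _))

sumTo-zero : ∀ f n → f ≗ zeroS → sumTo f n ≡ 0ℤ
sumTo-zero f zero e = refl
sumTo-zero f (suc n) e = cong₂ _+_ (e 0) (sumTo-zero (λ i → f (suc i)) n (λ i → e (suc i)))

sumTo-vanishing-tail : ∀ f {M N} → M ≤ N → (∀ l → M ≤ l → f l ≡ 0ℤ) → sumTo f N ≡ sumTo f M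
sumTo-vanishing-tail f {N = N} z≤n vanish = sumTo-zero f N (λ l → vanish l z≤n)
sumTo-vanishing-tail f (s≤s M≤N) vanish =
  cong (_+_ (f 0)) (sumTo-vanishing-tail (λ i → f (suc i)) M≤N (λ l le → vanish (suc l) (s≤s le)))

sumTo-shift : ∀ (fam : ℕ → Series) M n → sumTo (λ l → shift (fam l) n) M ≡ shift (λ m → sumTo (λ l → fam l m) M) n
sumTo-shift fam M zero = sumTo-zero (λ l → shift (fam l) 0) M (λ l → refl)
sumTo-shift fam M (suc n) = refl

-- The Cauchy product

conv : Series → Series → Series
conv a b n = sumTo (λ i → a i * b (n ∸ i)) (suc n)

convCoeff-conv : ∀ a q n → convCoeff a q n ≡ conv a (coeff q) n
convCoeff-conv a q n = sumℤ-applyUpTo (λ i → a i * coeff q (n ∸ i)) (λ i → i) (suc n)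

conv-congˡ : ∀ {a a'} b → a ≗ a' → conv a b ≗ conv a' b
conv-congˡ b e n = sumTo-cong (suc n) (λ i → cong (_* b (n ∸ i)) (e i))

conv-congʳ : ∀ a {b b'} → b ≗ b' → conv a b ≗ conv a b'
conv-congʳ a e n = sumTo-cong (suc n) (λ i → cong (a i *_) (e (n ∸ i)))

conv-⊕ˡ : ∀ a a' b n → conv (a ⊕ a') b n ≡ conv a b n + conv a' b n
conv-⊕ˡ a a' b n =
  trans (sumTo-cong (suc n) (λ i → ℤP.*-distribʳ-+ (b (n ∸ i)) (a i) (a' i)))
        (sumTo-⊕ (λ i → a i * b (n ∸ i)) (λ i → a' i * b (n ∸ i)) (suc n))

conv-scaleˡ : ∀ c a b n → conv (λ i → c * a i) b n ≡ c * conv a b n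
conv-scaleˡ c a b n =
  trans (sumTo-cong (suc n) (λ i → ℤP.*-assoc c (a i) (b (n ∸ i))))
        (sumTo-scale c (λ i → a i * b (n ∸ i)) (suc n))

conv-zeroˡ : ∀ b n → conv zeroS b n ≡ 0ℤ
conv-zeroˡ b n = sumTo-zero (λ i → 0ℤ * b (n ∸ i)) (suc n) (λ i → refl)

conv-shiftˡ : ∀ a b n → conv (shift a) b n ≡ shift (conv a b) n
conv-shiftˡ a b zero = refl
conv-shiftˡ a b (suc n) = ℤP.+-identityˡ _

conv-δ₀ˡ : ∀ b n → conv δ₀ b n ≡ b n
conv-δ₀ˡ b zero = trans (ℤP.+-identityʳ _) (ℤP.*-identityˡ _)
conv-δ₀ˡ b (suc n) =
  trans (cong₂ _+_ (ℤP.*-identityˡ (b (suc n)))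
                   (sumTo-zero (λ i → δ₀ (suc i) * b (n ∸ i)) (suc n) (λ i → refl)))
        (ℤP.+-identityʳ _)

conv-shiftByδ₀ˡ : ∀ l b → conv (shiftBy l δ₀) b ≗ shiftBy l b
conv-shiftByδ₀ˡ zero b n = conv-δ₀ˡ b n
conv-shiftByδ₀ˡ (suc l) b n =
  trans (conv-shiftˡ (shiftBy l δ₀) b n) (shift-cong (conv-shiftByδ₀ˡ l b) n)

coeff-+P : ∀ p q → coeff (p +P q) ≗ coeff p ⊕ coeff q
coeff-+P [] q n = sym (ℤP.+-identityˡ _)
coeff-+P (a ∷ p) [] n = sym (ℤP.+-identityʳ _)
coeff-+P (a ∷ p) (b ∷ q) zero = refl
coeff-+P (a ∷ p) (b ∷ q) (suc n) = coeff-+P p q n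

coeff-map : ∀ (f : ℤ → ℤ) → f 0ℤ ≡ 0ℤ → ∀ p n → coeff (map f p) n ≡ f (coeff p n)
coeff-map f f0 [] n = sym f0
coeff-map f f0 (a ∷ p) zero = refl
coeff-map f f0 (a ∷ p) (suc n) = coeff-map f f0 p n

coeff-scaleP : ∀ c p n → coeff (scaleP c p) n ≡ c * coeff p n
coeff-scaleP c = coeff-map (c *_) (ℤP.*-zeroʳ c)

coeff-0∷ : ∀ p → coeff (0ℤ ∷ p) ≗ shift (coeff p)
coeff-0∷ p zero = refl
coeff-0∷ p (suc n) = refl

coeff-∷ : ∀ a p → coeff (a ∷ p) ≗ (λ i → a * δ₀ i) ⊕ shift (coeff p)
coeff-∷ a p zero = sym (trans (ℤP.+-identityʳ _) (ℤP.*-identityʳ a))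
coeff-∷ a p (suc n) = sym (trans (cong (_+ coeff p n) (ℤP.*-zeroʳ a)) (ℤP.+-identityˡ _))

coeff-*P : ∀ p q → coeff (p *P q) ≗ conv (coeff p) (coeff q)
coeff-*P [] q n = sym (conv-zeroˡ (coeff q) n)
coeff-*P (a ∷ p) q n = begin
  coeff (scaleP a q +P (0ℤ ∷ (p *P q))) n
    ≡⟨ coeff-+P (scaleP a q) (0ℤ ∷ (p *P q)) n ⟩
  coeff (scaleP a q) n + coeff (0ℤ ∷ (p *P q)) n
    ≡⟨ cong₂ _+_ (coeff-scaleP a q n) (coeff-0∷ (p *P q) n) ⟩
  a * coeff q n + shift (coeff (p *P q)) n
    ≡⟨ cong₂ _+_ (cong (a *_) (sym (conv-δ₀ˡ (coeff q) n))) (shift-cong (coeff-*P p q) n) ⟩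
  a * conv δ₀ (coeff q) n + shift (conv (coeff p) (coeff q)) n
    ≡⟨ sym (cong₂ _+_ (conv-scaleˡ a δ₀ (coeff q) n) (conv-shiftˡ (coeff p) (coeff q) n)) ⟩
  conv (λ i → a * δ₀ i) (coeff q) n + conv (shift (coeff p)) (coeff q) n
    ≡⟨ sym (conv-⊕ˡ (λ i → a * δ₀ i) (shift (coeff p)) (coeff q) n) ⟩
  conv ((λ i → a * δ₀ i) ⊕ shift (coeff p)) (coeff q) n
    ≡⟨ sym (conv-congˡ (coeff q) (coeff-∷ a p) n) ⟩
  conv (coeff (a ∷ p)) (coeff q) n ∎

coeff-1 : coeff oneP ≗ δ₀
coeff-1 zero = refl
coeff-1 (suc n) = refl

coeff-t : coeff tP ≗ shiftBy 1 δ₀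
coeff-t zero = refl
coeff-t (suc zero) = refl
coeff-t (suc (suc n)) = refl

coeff-1+t : coeff (oneP +P tP) ≗ δ₀ ⊕ shift δ₀
coeff-1+t zero = refl
coeff-1+t (suc zero) = refl
coeff-1+t (suc (suc n)) = refl

coeff-t*P : ∀ q → coeff (tP *P q) ≗ shift (coeff q)
coeff-t*P q n = trans (coeff-*P tP q n)
  (trans (conv-congˡ (coeff q) coeff-t n) (conv-shiftByδ₀ˡ 1 (coeff q) n))

coeff-1+t*P : ∀ q → coeff ((oneP +P tP) *P q) ≗ coeff q ⊕ shift (coeff q)
coeff-1+t*P q n = begin
  coeff ((oneP +P tP) *P q) n             ≡⟨ coeff-*P (oneP +P tP) q n ⟩
  conv (coeff (oneP +P tP)) (coeff q) n   ≡⟨ conv-congˡ (coeff q) coeff-1+t n ⟩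
  conv (δ₀ ⊕ shift δ₀) (coeff q) n        ≡⟨ conv-⊕ˡ δ₀ (shift δ₀) (coeff q) n ⟩
  conv δ₀ (coeff q) n + conv (shift δ₀) (coeff q) n
    ≡⟨ cong₂ _+_ (conv-δ₀ˡ (coeff q) n) (conv-shiftByδ₀ˡ 1 (coeff q) n) ⟩
  coeff q n + shift (coeff q) n           ∎

coeff-t^ : ∀ l → coeff (tP ^P l) ≗ shiftBy l δ₀
coeff-t^ zero = coeff-1
coeff-t^ (suc l) n = trans (coeff-t*P (tP ^P l) n) (shift-cong (coeff-t^ l) n)

coeff-t^*P : ∀ l q → coeff ((tP ^P l) *P q) ≗ shiftBy l (coeff q)
coeff-t^*P l q n = trans (coeff-*P (tP ^P l) q n)
  (trans (conv-congˡ (coeff q) (coeff-t^ l) n) (conv-shiftByδ₀ˡ l (coeff q) n))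

binom : ℕ → Series
binom j m = + (j C m)

pascal : ∀ j → binom (suc j) ≗ binom j ⊕ shift (binom j)
pascal j zero = sym (ℤP.+-identityʳ (binom j 0))
pascal j (suc i) = trans (cong +_ (sym (nCk+nC[k+1]≡[n+1]C[k+1] j i)))
  (trans (ℤP.pos-+ (j C i) (j C suc i)) (ℤP.+-comm (+ (j C i)) (+ (j C suc i))))

coeff-1+t^ : ∀ j → coeff ((oneP +P tP) ^P j) ≗ binom j
coeff-1+t^ zero zero = refl
coeff-1+t^ zero (suc n) = sym (cong +_ (k>n⇒nCk≡0 {n = 0} {k = suc n} (s≤s z≤n)))
coeff-1+t^ (suc j) n = begin
  coeff ((oneP +P tP) *P ((oneP +P tP) ^P j)) n   ≡⟨ coeff-1+t*P ((oneP +P tP) ^P j) n ⟩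
  coeff ((oneP +P tP) ^P j) n + shift (coeff ((oneP +P tP) ^P j)) n
    ≡⟨ cong₂ _+_ (coeff-1+t^ j n) (shift-cong (coeff-1+t^ j) n) ⟩
  binom j n + shift (binom j) n                   ≡⟨ sym (pascal j n) ⟩
  binom (suc j) n                                 ∎

pascal-shifted : ∀ l j n → shiftBy l (binom (suc j)) n ≡ shiftBy l (binom j) n + shiftBy (suc l) (binom j) n
pascal-shifted l j n =
  trans (shiftBy-cong l (pascal j) n)
        (trans (shiftBy-⊕ l (binom j) (shift (binom j)) n)
               (cong (_+_ (shiftBy l (binom j) n)) (shiftBy-shift l (binom j) n)))

sgn : ℕ → ℤ
sgn zero = 1ℤ
sgn (suc n) = - sgn n

coeff-negArg : ∀ p n → coeff (negArg p) n ≡ sgn n * coeff p n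
coeff-negArg [] n = sym (ℤP.*-zeroʳ (sgn n))
coeff-negArg (a ∷ p) zero = sym (ℤP.*-identityˡ a)
coeff-negArg (a ∷ p) (suc n) = begin
  coeff (map -_ (negArg p)) n   ≡⟨ coeff-map -_ refl (negArg p) n ⟩
  - coeff (negArg p) n          ≡⟨ cong -_ (coeff-negArg p n) ⟩
  - (sgn n * coeff p n)         ≡⟨ ℤP.neg-distribˡ-* (sgn n) (coeff p n) ⟩
  - sgn n * coeff p n           ∎

-- Coefficients of the Delannoy polynomials and their recurrence

delTerm : ℕ → ℕ → Series
delTerm k l n = + ((k ∸ l) C l) * shiftBy l (binom (k ∸ 2 ℕ.* l)) n

coeff-delTerm : ∀ k l →
  coeff (scaleP (+ ((k ∸ l) C l)) ((tP ^P l) *P ((oneP +P tP) ^P (k ∸ 2 ℕ.* l)))) ≗ delTerm k l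
coeff-delTerm k l n =
  trans (coeff-scaleP (+ ((k ∸ l) C l)) ((tP ^P l) *P ((oneP +P tP) ^P (k ∸ 2 ℕ.* l))) n)
        (cong (+ ((k ∸ l) C l) *_)
          (trans (coeff-t^*P l ((oneP +P tP) ^P (k ∸ 2 ℕ.* l)) n)
                 (shiftBy-cong l (coeff-1+t^ (k ∸ 2 ℕ.* l)) n)))

delTerm-lead : ∀ k → delTerm k 0 ≗ binom k
delTerm-lead k n = ℤP.*-identityˡ (binom k n)

-- summands with 2l > k vanish, since then C(k-l, l) = 0
delTerm-vanish : ∀ k l n → k < l ℕ.+ l → delTerm k l n ≡ 0ℤ
delTerm-vanish k (suc l) n k<2l+2 =
  cong (λ c → + c * shiftBy (suc l) (binom (k ∸ 2 ℕ.* suc l)) n)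
       (k>n⇒nCk≡0 (ℕP.m<n+o⇒m∸n<o k (suc l) k<2l+2))

delCoeff : ℕ → Series
delCoeff k n = sumTo (λ l → delTerm k l n) (suc k)

half-bound : ∀ k l → suc (k / 2) ≤ l → k < l ℕ.+ l
half-bound k l h =
  subst (_< l ℕ.+ l) (sym (m≡m%n+[m/n]*n k 2))
    (ℕP.<-≤-trans (ℕP.+-monoˡ-< (k / 2 ℕ.* 2) (m%n<n k 2))
                  (ℕP.≤-trans (ℕP.*-monoˡ-≤ 2 h) (ℕP.≤-reflexive l*2≡l+l)))
  where
  l*2≡l+l : l ℕ.* 2 ≡ l ℕ.+ l
  l*2≡l+l = trans (ℕP.*-comm l 2) (cong (l ℕ.+_) (ℕP.+-identityʳ l))

-- the summation bound ⌊k/2⌋ of Defs may be raised to k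
coeff-delannoy : ∀ k → coeff (delannoy k) ≗ delCoeff k
coeff-delannoy k n = begin
  coeff (sumP (map term (applyUpTo (λ l → l) (suc (k / 2))))) n
    ≡⟨ coeff-sumP (applyUpTo (λ l → l) (suc (k / 2))) ⟩
  sumℤ (map (λ l → coeff (term l) n) (applyUpTo (λ l → l) (suc (k / 2))))
    ≡⟨ sumℤ-applyUpTo (λ l → coeff (term l) n) (λ l → l) (suc (k / 2)) ⟩
  sumTo (λ l → coeff (term l) n) (suc (k / 2))
    ≡⟨ sumTo-cong (suc (k / 2)) (λ l → coeff-delTerm k l n) ⟩
  sumTo (λ l → delTerm k l n) (suc (k / 2))
    ≡⟨ sym (sumTo-vanishing-tail (λ l → delTerm k l n) (s≤s (m/n≤m k 2))
                                 (λ l le → delTerm-vanish k l n (half-bound k l le))) ⟩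
  delCoeff k n ∎
  where
  term : ℕ → Poly
  term l = scaleP (+ ((k ∸ l) C l)) ((tP ^P l) *P ((oneP +P tP) ^P (k ∸ 2 ℕ.* l)))
  coeff-sumP : ∀ ls → coeff (sumP (map term ls)) n ≡ sumℤ (map (λ l → coeff (term l) n) ls)
  coeff-sumP [] = refl
  coeff-sumP (l ∷ ls) = trans (coeff-+P (term l) _ n) (cong (_+_ (coeff (term l) n)) (coeff-sumP ls))

-- C(k+1-l, l+1) = C(k-l, l) + C(k-l, l+1); for l > k both sides are 0
pascal-diagonal : ∀ k l → (suc k ∸ l) C suc l ≡ (k ∸ l) C l ℕ.+ (k ∸ l) C suc l
pascal-diagonal k l with l ℕ.≤? k
... | yes l≤k = trans (cong (_C suc l) (ℕP.+-∸-assoc 1 l≤k))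
                      (sym (nCk+nC[k+1]≡[n+1]C[k+1] (k ∸ l) l))
... | no l≰k rewrite ℕP.m≤n⇒m∸n≡0 (ℕP.≰⇒> l≰k) | ℕP.m≤n⇒m∸n≡0 (ℕP.<⇒≤ (ℕP.≰⇒> l≰k)) =
  zero-row (ℕP.≰⇒> l≰k)
  where
  zero-row : ∀ {m} → k < m → 0 C suc m ≡ 0 C m ℕ.+ 0 C suc m
  zero-row {suc m} _ = refl

binom-index₂ : ∀ k l → suc (suc k) ∸ 2 ℕ.* suc l ≡ k ∸ 2 ℕ.* l
binom-index₂ k l = cong (suc (suc k) ∸_) (ℕP.*-suc 2 l)

binom-index₁ : ∀ k l → suc k ∸ 2 ℕ.* suc l ≡ (k ∸ 2 ℕ.* l) ∸ 1
binom-index₁ k l = trans (cong (suc k ∸_) (ℕP.*-suc 2 l))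
  (trans (cong (k ∸_) (ℕP.+-comm 1 (2 ℕ.* l))) (sym (ℕP.∸-+-assoc k (2 ℕ.* l) 1)))

delTerm-step : ∀ k l → delTerm (suc (suc k)) (suc l) ≗
  (delTerm (suc k) (suc l) ⊕ shift (delTerm (suc k) (suc l))) ⊕ shift (delTerm k l)
delTerm-step k l zero = trans (ℤP.*-zeroʳ (+ ((suc k ∸ l) C suc l)))
  (sym (cong (λ c → (c + 0ℤ) + 0ℤ) (ℤP.*-zeroʳ (+ ((k ∸ l) C suc l)))))
delTerm-step k l (suc m) rewrite binom-index₂ k l | binom-index₁ k l = begin
  + ((suc k ∸ l) C suc l) * X     ≡⟨ cong (λ c → + c * X) (pascal-diagonal k l) ⟩
  + (a ℕ.+ b) * X                  ≡⟨ cong (_* X) (ℤP.pos-+ a b) ⟩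
  (+ a + + b) * X                  ≡⟨ ℤP.*-distribʳ-+ X (+ a) (+ b) ⟩
  + a * X + + b * X                ≡⟨ cong (_+_ (+ a * X)) (split (k ∸ 2 ℕ.* l) refl) ⟩
  + a * X + (+ b * Y + + b * Y′)   ≡⟨ ℤP.+-comm (+ a * X) _ ⟩
  (+ b * Y + + b * Y′) + + a * X   ∎
  where
  a b : ℕ
  a = (k ∸ l) C l
  b = (k ∸ l) C suc l
  X Y Y′ : ℤ
  X = shiftBy l (binom (k ∸ 2 ℕ.* l)) m
  Y = shiftBy l (binom ((k ∸ 2 ℕ.* l) ∸ 1)) m
  Y′ = shiftBy (suc l) (binom ((k ∸ 2 ℕ.* l) ∸ 1)) m
  -- if k = 2l then b = 0, otherwise (1+t)^{k-2l} splits by Pascal's rule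
  split : ∀ j → k ∸ 2 ℕ.* l ≡ j →
    + b * shiftBy l (binom j) m ≡ + b * shiftBy l (binom (j ∸ 1)) m + + b * shiftBy (suc l) (binom (j ∸ 1)) m
  split zero k≤2l rewrite k>n⇒nCk≡0 {n = k ∸ l} {k = suc l}
    (s≤s (ℕP.m≤n+o⇒m∸n≤o k l (subst (k ≤_) (cong (l ℕ.+_) (ℕP.+-identityʳ l)) (ℕP.m∸n≡0⇒m≤n k≤2l)))) = refl
  split (suc j) _ = trans (cong (+ b *_) (pascal-shifted l j m))
    (ℤP.*-distribˡ-+ (+ b) (shiftBy l (binom j) m) (shiftBy (suc l) (binom j) m))

delCoeff-rec : ∀ k → delCoeff (suc (suc k)) ≗ (delCoeff (suc k) ⊕ shift (delCoeff (suc k))) ⊕ shift (delCoeff k)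
delCoeff-rec k n = begin
  delTerm (2 ℕ.+ k) 0 n + sumTo (λ l → delTerm (2 ℕ.+ k) (suc l) n) (2 ℕ.+ k)
    ≡⟨ cong₂ _+_ lead (sumTo-cong (2 ℕ.+ k) (λ l → delTerm-step k l n)) ⟩
  (T₀ n + shift T₀ n) + sumTo ((λ l → T l n) ⊕ (λ l → shift (T l) n) ⊕ (λ l → shift (delTerm k l) n)) (2 ℕ.+ k)
    ≡⟨ cong (_+_ (T₀ n + shift T₀ n))
         (trans (sumTo-⊕ ((λ l → T l n) ⊕ (λ l → shift (T l) n)) (λ l → shift (delTerm k l) n) (2 ℕ.+ k))
                (cong (_+ sumTo (λ l → shift (delTerm k l) n) (2 ℕ.+ k)) (sumTo-⊕ (λ l → T l n) (λ l → shift (T l) n) (2 ℕ.+ k)))) ⟩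
  (T₀ n + shift T₀ n) + ((sumTo (λ l → T l n) (2 ℕ.+ k) + sumTo (λ l → shift (T l) n) (2 ℕ.+ k))
                          + sumTo (λ l → shift (delTerm k l) n) (2 ℕ.+ k))
    ≡⟨ cong (_+_ (T₀ n + shift T₀ n))
         (cong₂ _+_ (cong₂ _+_ (drop-last n) (trans (sumTo-shift T (2 ℕ.+ k) n) (shift-cong drop-last n)))
                    (trans (sumTo-shift (delTerm k) (2 ℕ.+ k) n)
                           (shift-cong (λ m → sumTo-vanishing-tail (λ l → delTerm k l m) (ℕP.n≤1+n (suc k))
                                                (λ l le → delTerm-vanish k l m (ℕP.≤-trans le (ℕP.m≤m+n l l)))) n))) ⟩
  (T₀ n + shift T₀ n) + ((P n + shift P n) + shift (delCoeff k) n)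
    ≡⟨ regroup (T₀ n) (shift T₀ n) (P n) (shift P n) (shift (delCoeff k) n) ⟩
  ((T₀ n + P n) + (shift T₀ n + shift P n)) + shift (delCoeff k) n
    ≡⟨ cong (λ x → (delCoeff (suc k) n + x) + shift (delCoeff k) n) (shift-⊕ n) ⟩
  (delCoeff (suc k) n + shift (delCoeff (suc k)) n) + shift (delCoeff k) n ∎
  where
  T₀ : Series
  T₀ = delTerm (suc k) 0
  T : ℕ → Series
  T l = delTerm (suc k) (suc l)
  P : Series
  P m = sumTo (λ l → T l m) (suc k)
  lead : delTerm (2 ℕ.+ k) 0 n ≡ T₀ n + shift T₀ n
  lead = trans (delTerm-lead (2 ℕ.+ k) n) (trans (pascal (suc k) n)
           (sym (cong₂ _+_ (delTerm-lead (suc k) n) (shift-cong (delTerm-lead (suc k)) n))))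
  drop-last : ∀ m → sumTo (λ l → T l m) (2 ℕ.+ k) ≡ P m
  drop-last m = sumTo-vanishing-tail (λ l → T l m) (ℕP.n≤1+n (suc k))
    (λ l le → delTerm-vanish (suc k) (suc l) m (ℕP.≤-trans (s≤s le) (ℕP.m≤m+n (suc l) (suc l))))
  shift-⊕ : ∀ m → shift T₀ m + shift P m ≡ shift (delCoeff (suc k)) m
  shift-⊕ zero = refl
  shift-⊕ (suc m) = refl
  regroup : ∀ a b c d e → (a + b) + ((c + d) + e) ≡ ((a + c) + (b + d)) + e
  regroup = solve-∀

-- The series D_j = d_{j-1}(-t), with D_0 = 0

dPrev : ℕ → Series
dPrev zero = zeroS
dPrev (suc j) = delCoeff j

dPrev-rec : ∀ j → dPrev (suc (suc j)) ≗ (dPrev (suc j) ⊕ shift (dPrev (suc j))) ⊕ shift (dPrev j)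
dPrev-rec zero n = begin
  delCoeff 1 n                             ≡⟨ ℤP.+-identityʳ _ ⟩
  delTerm 1 0 n                            ≡⟨ delTerm-lead 1 n ⟩
  binom 1 n                                ≡⟨ pascal 0 n ⟩
  binom 0 n + shift (binom 0) n            ≡⟨ sym (cong₂ _+_ (d₀ n) (shift-cong d₀ n)) ⟩
  delCoeff 0 n + shift (delCoeff 0) n      ≡⟨ sym (ℤP.+-identityʳ _) ⟩
  (delCoeff 0 n + shift (delCoeff 0) n) + 0ℤ
    ≡⟨ cong (_+_ (delCoeff 0 n + shift (delCoeff 0) n)) (sym (shift-zero n)) ⟩
  (delCoeff 0 n + shift (delCoeff 0) n) + shift zeroS n ∎
  where
  d₀ : delCoeff 0 ≗ binom 0
  d₀ m = trans (ℤP.+-identityʳ _) (delTerm-lead 0 m)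
dPrev-rec (suc j) = delCoeff-rec j

dNeg : ℕ → Series
dNeg j n = sgn n * dPrev j n

dNeg-zero : dNeg 0 ≗ zeroS
dNeg-zero n = ℤP.*-zeroʳ (sgn n)

coeff-negDelannoy : ∀ k → coeff (negArg (delannoy k)) ≗ dNeg (suc k)
coeff-negDelannoy k n = trans (coeff-negArg (delannoy k) n) (cong (sgn n *_) (coeff-delannoy k n))

dNeg-rec : ∀ j → dNeg (suc j) ≗ (dNeg (suc (suc j)) ⊕ shift (dNeg j)) ⊕ shift (dNeg (suc j))
dNeg-rec j zero =
  trans (at-zero (dPrev (suc j) 0)) (cong (λ x → (1ℤ * x + 0ℤ) + 0ℤ) (sym (dPrev-rec j 0)))
  where
  at-zero : ∀ a → 1ℤ * a ≡ (1ℤ * ((a + 0ℤ) + 0ℤ) + 0ℤ) + 0ℤ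
  at-zero = solve-∀
dNeg-rec j (suc n) =
  trans (at-suc (sgn n) (dPrev (suc j) (suc n)) (dPrev (suc j) n) (dPrev j n))
        (cong (λ x → (- sgn n * x + sgn n * dPrev j n) + sgn n * dPrev (suc j) n) (sym (dPrev-rec j (suc n))))
  where
  at-suc : ∀ s a b c → - s * a ≡ (- s * ((a + b) + c) + s * c) + s * b
  at-suc = solve-∀

-- Counting strip paths by their first step

length-filterᵇ-++ : ∀ {A : Set} (p : A → Bool) xs ys →
  length (filterᵇ p (xs ++ ys)) ≡ length (filterᵇ p xs) ℕ.+ length (filterᵇ p ys)
length-filterᵇ-++ p xs ys =
  trans (cong length (filter-++ (λ x → T? (p x)) xs ys)) (length-++ (filterᵇ p xs))

length-filterᵇ-map : ∀ {A B : Set} (p : B → Bool) (f : A → B) xs →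
  length (filterᵇ p (map f xs)) ≡ length (filterᵇ (λ x → p (f x)) xs)
length-filterᵇ-map p f [] = refl
length-filterᵇ-map p f (x ∷ xs) with p (f x)
... | true = cong suc (length-filterᵇ-map p f xs)
... | false = length-filterᵇ-map p f xs

length-filterᵇ-none : ∀ {A : Set} (xs : List A) → length (filterᵇ (λ _ → false) xs) ≡ 0
length-filterᵇ-none [] = refl
length-filterᵇ-none (x ∷ xs) = length-filterᵇ-none xs

guarded : Bool → Series → Series
guarded true f = f
guarded false f = zeroS

guarded-true : ∀ {b} f → b ≡ true → guarded b f ≗ f
guarded-true f refl n = refl

guarded-false : ∀ {b} f → b ≡ false → guarded b f ≗ zeroS
guarded-false f refl n = refl

guarded-shift-0 : ∀ b f → guarded b (shift f) 0 ≡ 0ℤ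
guarded-shift-0 true f = refl
guarded-shift-0 false f = refl

guarded-count : ∀ b x (f : Series) n → + x ≡ f n → + (if b then x else 0) ≡ guarded b f n
guarded-count true x f n e = e
guarded-count false x f n e = refl

up-guard : ∀ h j → (suc h <ᵇ h ℕ.+ suc j) ≡ (0 <ᵇ j)
up-guard zero j = refl
up-guard (suc h) j = up-guard h j

excess-suc : ∀ h n → h ℕ.+ 2 ℕ.* suc n ≡ suc (suc (h ℕ.+ 2 ℕ.* n))
excess-suc h n = trans (cong (h ℕ.+_) (ℕP.*-suc 2 n))
  (trans (ℕP.+-suc h (suc (2 ℕ.* n))) (cong suc (ℕP.+-suc h (2 ℕ.* n))))

module StripPaths (k : ℕ) where

  paths : ℕ → ℕ → ℕ
  paths h m = length (filterᵇ (inStrip k h) (allWords m))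

  upCount downCount flatCount : ℕ → ℕ → ℕ
  upCount h m = if suc h <ᵇ k then paths (suc h) m else 0
  downCount zero m = 0
  downCount (suc h) m = paths h m
  flatCount h zero = 0
  flatCount h (suc m) = paths h m

  first-U : ∀ h ws → length (filterᵇ (inStrip k h) (map (U ∷_) ws))
                     ≡ (if suc h <ᵇ k then length (filterᵇ (inStrip k (suc h)) ws) else 0)
  first-U h ws = trans (length-filterᵇ-map (inStrip k h) (U ∷_) ws) (by-guard (suc h <ᵇ k))
    where
    by-guard : ∀ b → length (filterᵇ (λ w → b ∧ inStrip k (suc h) w) ws)
                     ≡ (if b then length (filterᵇ (inStrip k (suc h)) ws) else 0)
    by-guard true = refl
    by-guard false = length-filterᵇ-none ws

  first-D : ∀ h m → length (filterᵇ (inStrip k h) (map (D ∷_) (allWords m))) ≡ downCount h m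
  first-D zero m = trans (length-filterᵇ-map (inStrip k 0) (D ∷_) (allWords m)) (length-filterᵇ-none (allWords m))
  first-D (suc h) m = length-filterᵇ-map (inStrip k (suc h)) (D ∷_) (allWords m)

  first-F : ∀ h m → length (filterᵇ (inStrip k h) (map (F ∷_) (allWords m))) ≡ flatCount h (suc m)
  first-F h m = length-filterᵇ-map (inStrip k h) (F ∷_) (allWords m)

  paths-step : ∀ h m → paths h (suc m) ≡ upCount h m ℕ.+ (downCount h m ℕ.+ flatCount h m)
  paths-step h zero =
    trans (length-filterᵇ-++ (inStrip k h) (map (U ∷_) (allWords 0)) (map (D ∷_) (allWords 0)))
          (cong₂ ℕ._+_ (first-U h (allWords 0)) (trans (first-D h 0) (sym (ℕP.+-identityʳ _))))
  paths-step h (suc m) =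
    trans (length-filterᵇ-++ (inStrip k h) (map (U ∷_) (allWords (suc m))) _)
      (cong₂ ℕ._+_ (first-U h (allWords (suc m)))
        (trans (length-filterᵇ-++ (inStrip k h) (map (D ∷_) (allWords (suc m))) (map (F ∷_) (allWords m)))
               (cong₂ ℕ._+_ (first-D h (suc m)) (first-F h m))))

  mutual
    paths-vanish : ∀ m h → m < h → paths h m ≡ 0
    paths-vanish zero (suc h) _ = refl
    paths-vanish (suc m) (suc h) (s≤s m<h) =
      trans (paths-step (suc h) m)
        (cong₂ ℕ._+_ (upCount-vanish m (suc h) (ℕP.m<n⇒m<1+n (ℕP.m<n⇒m<1+n m<h)))
                     (cong₂ ℕ._+_ (paths-vanish m h m<h) (flatCount-vanish m (suc h) (ℕP.m<n⇒m<1+n m<h))))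

    upCount-vanish : ∀ m h → m < suc h → upCount h m ≡ 0
    upCount-vanish m h m<h+1 with suc h <ᵇ k
    ... | true = paths-vanish m (suc h) m<h+1
    ... | false = refl

    flatCount-vanish : ∀ m h → m < h → flatCount h m ≡ 0
    flatCount-vanish zero h _ = refl
    flatCount-vanish (suc m) h m+1<h = paths-vanish m h (ℕP.<-trans (ℕP.n<1+n m) m+1<h)

  flatCount-pred : ∀ h m → flatCount (suc h) m ≡ paths (suc h) (m ∸ 1)
  flatCount-pred h zero = refl
  flatCount-pred h (suc m) = refl

  A : ℕ → Series
  A h n = + paths h (h ℕ.+ 2 ℕ.* n)

  paths-shorter : ∀ g n → + paths (suc g) (g ℕ.+ 2 ℕ.* n ∸ 1) ≡ shift (A (suc g)) n
  paths-shorter g zero = cong +_ (paths-vanish (g ℕ.+ 0 ∸ 1) (suc g)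
    (s≤s (ℕP.≤-trans (ℕP.m∸n≤m (g ℕ.+ 0) 1) (ℕP.≤-reflexive (ℕP.+-identityʳ g)))))
  paths-shorter g (suc n) = cong (λ m → + paths (suc g) (m ∸ 1)) (excess-suc g n)

  up : ℕ → Series
  up h = guarded (suc h <ᵇ k) (shift (A (suc h)))

  A-rec₀ : A 0 ≗ (δ₀ ⊕ up 0) ⊕ shift (A 0)
  A-rec₀ zero = cong (λ x → (1ℤ + x) + 0ℤ) (sym (guarded-shift-0 (1 <ᵇ k) (A 1)))
  A-rec₀ (suc n) = begin
    + paths 0 (2 ℕ.* suc n)                             ≡⟨ cong (λ m → + paths 0 m) (excess-suc 0 n) ⟩
    + paths 0 (suc (suc (2 ℕ.* n)))                     ≡⟨ cong +_ (paths-step 0 (suc (2 ℕ.* n))) ⟩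
    + (upCount 0 (suc (2 ℕ.* n)) ℕ.+ paths 0 (2 ℕ.* n)) ≡⟨ ℤP.pos-+ (upCount 0 (suc (2 ℕ.* n))) _ ⟩
    + upCount 0 (suc (2 ℕ.* n)) + A 0 n
      ≡⟨ cong (_+ A 0 n) (trans (guarded-count (1 <ᵇ k) _ (shift (A 1)) (suc n) refl) (sym (ℤP.+-identityˡ _))) ⟩
    (0ℤ + up 0 (suc n)) + A 0 n                         ∎

  A-rec : ∀ h → A (suc h) ≗ (up (suc h) ⊕ A h) ⊕ shift (A (suc h))
  A-rec h n = begin
    + paths (suc h) (suc m)                                            ≡⟨ cong +_ (paths-step (suc h) m) ⟩
    + (upCount (suc h) m ℕ.+ (paths h m ℕ.+ flatCount (suc h) m))
      ≡⟨ cong +_ (sym (ℕP.+-assoc (upCount (suc h) m) _ _)) ⟩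
    + ((upCount (suc h) m ℕ.+ paths h m) ℕ.+ flatCount (suc h) m)
      ≡⟨ trans (ℤP.pos-+ (upCount (suc h) m ℕ.+ paths h m) _) (cong (_+ + flatCount (suc h) m) (ℤP.pos-+ (upCount (suc h) m) (paths h m))) ⟩
    (+ upCount (suc h) m + A h n) + + flatCount (suc h) m
      ≡⟨ cong₂ _+_ (cong (_+ A h n) (guarded-count (suc (suc h) <ᵇ k) _ (shift (A (suc (suc h)))) n (paths-shorter (suc h) n)))
                   (trans (cong +_ (flatCount-pred h m)) (paths-shorter h n)) ⟩
    (up (suc h) n + A h n) + shift (A (suc h)) n                       ∎
    where
    m : ℕ
    m = h ℕ.+ 2 ℕ.* n

  up-guard-in : ∀ h j → h ℕ.+ suc j ≡ k → (suc h <ᵇ k) ≡ (0 <ᵇ j)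
  up-guard-in h j eq = trans (cong (suc h <ᵇ_) (sym eq)) (up-guard h j)

  E : Series
  E = dNeg (suc k)

  -- A_h · d_k(-t) = D_{k-h}, by induction on the coefficient n and then on h;
  -- the two companions state the same for the shifted terms t A_h and t A_{h+1}
  mutual
    gf-identity : ∀ n h j → h ℕ.+ suc j ≡ k → conv (A h) E n ≡ dNeg (suc j) n
    gf-identity n zero j eq = begin
      conv (A 0) E n                                          ≡⟨ conv-congˡ E A-rec₀ n ⟩
      conv ((δ₀ ⊕ up 0) ⊕ shift (A 0)) E n                     ≡⟨ conv-⊕ˡ (δ₀ ⊕ up 0) (shift (A 0)) E n ⟩
      conv (δ₀ ⊕ up 0) E n + conv (shift (A 0)) E n
        ≡⟨ cong (_+ conv (shift (A 0)) E n) (conv-⊕ˡ δ₀ (up 0) E n) ⟩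
      (conv δ₀ E n + conv (up 0) E n) + conv (shift (A 0)) E n
        ≡⟨ cong₂ _+_ (cong₂ _+_ (trans (conv-δ₀ˡ E n) (cong (λ m → dNeg (suc m) n) (sym eq)))
                                (up-identity n 0 j eq))
                     (shifted-identity n 0 j eq) ⟩
      (dNeg (suc (suc j)) n + shift (dNeg j) n) + shift (dNeg (suc j)) n  ≡⟨ sym (dNeg-rec j n) ⟩
      dNeg (suc j) n                                          ∎
    gf-identity n (suc h) j eq = begin
      conv (A (suc h)) E n                                    ≡⟨ conv-congˡ E (A-rec h) n ⟩
      conv ((up (suc h) ⊕ A h) ⊕ shift (A (suc h))) E n
        ≡⟨ conv-⊕ˡ (up (suc h) ⊕ A h) (shift (A (suc h))) E n ⟩
      conv (up (suc h) ⊕ A h) E n + conv (shift (A (suc h))) E n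
        ≡⟨ cong (_+ conv (shift (A (suc h))) E n) (conv-⊕ˡ (up (suc h)) (A h) E n) ⟩
      (conv (up (suc h)) E n + conv (A h) E n) + conv (shift (A (suc h))) E n
        ≡⟨ cong₂ _+_ (cong₂ _+_ (up-identity n (suc h) j eq)
                                (gf-identity n h (suc j) (trans (ℕP.+-suc h (suc j)) eq)))
                     (shifted-identity n (suc h) j eq) ⟩
      (shift (dNeg j) n + dNeg (suc (suc j)) n) + shift (dNeg (suc j)) n
        ≡⟨ cong (_+ shift (dNeg (suc j)) n) (ℤP.+-comm (shift (dNeg j) n) _) ⟩
      (dNeg (suc (suc j)) n + shift (dNeg j) n) + shift (dNeg (suc j)) n  ≡⟨ sym (dNeg-rec j n) ⟩
      dNeg (suc j) n                                          ∎

    up-identity : ∀ n h j → h ℕ.+ suc j ≡ k → conv (up h) E n ≡ shift (dNeg j) n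
    up-identity n h zero eq = begin
      conv (up h) E n         ≡⟨ conv-congˡ E (guarded-false (shift (A (suc h))) (up-guard-in h 0 eq)) n ⟩
      conv zeroS E n          ≡⟨ conv-zeroˡ E n ⟩
      0ℤ                      ≡⟨ sym (trans (shift-cong dNeg-zero n) (shift-zero n)) ⟩
      shift (dNeg 0) n        ∎
    up-identity n h (suc j) eq =
      trans (conv-congˡ E (guarded-true (shift (A (suc h))) (up-guard-in h (suc j) eq)) n)
            (shifted-identity n (suc h) j (trans (sym (ℕP.+-suc h (suc j))) eq))

    shifted-identity : ∀ n h j → h ℕ.+ suc j ≡ k → conv (shift (A h)) E n ≡ shift (dNeg (suc j)) n
    shifted-identity zero h j eq = conv-shiftˡ (A h) E zero
    shifted-identity (suc n) h j eq = trans (conv-shiftˡ (A h) E (suc n)) (gf-identity n h j eq)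

mainTheorem11 : (k : ℕ) → k ≥ 1 → (n : ℕ) →
    convCoeff (λ i → + S k i) (negArg (delannoy k)) n ≡ coeff (negArg (delannoy (k ∸ 1))) n
mainTheorem11 zero () n
mainTheorem11 (suc j) _ n = begin
  convCoeff (A 0) (negArg (delannoy (suc j))) n    ≡⟨ convCoeff-conv (A 0) (negArg (delannoy (suc j))) n ⟩
  conv (A 0) (coeff (negArg (delannoy (suc j)))) n ≡⟨ conv-congʳ (A 0) (coeff-negDelannoy (suc j)) n ⟩
  conv (A 0) (dNeg (suc (suc j))) n                ≡⟨ gf-identity n 0 j refl ⟩
  dNeg (suc j) n                                   ≡⟨ sym (coeff-negDelannoy j n) ⟩
  coeff (negArg (delannoy j)) n                    ∎
  where open StripPaths (suc j)
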